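{- Let $\pi\in\mathfrak{S}_n$ be an indecomposable permutation, let $G=G_\pi$ be its permutation graph, and let $s\in[n]$ be a distinguished vertex (the sink). For a spanning tree $T$ of $G$, rooted at $s$, define the configuration $c(T)=(c_1(T),\ldots,c_n(T))$ by $$c_i(T):=\lambda_i(T)+\mu_i(T)+\nu_i(T).$$ Then the map $\phi_{TC}:T\mapsto c(T)$ is a bijection from the set of spanning trees of $G$ to the set $\mathrm{Rec}_s(G)$ of recurrent configurations of the Abelian sandpile model on $G$ with sink $s$. Moreover, for every spanning tree $T$ of $G$, $$\mathrm{level}(c(T))=\sum_{i=1}^n\left(\tfrac12\mu_i(T)+\nu_i(T)\right),$$ and the canonical toppling of $c(T)$ is $T^{(0)},T^{(1)},T^{(2)},\ldots$ (the vertices of $T$ grouped by height, i.e. its breadth-first search).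
   Context: For $\pi=\pi_1\cdots\pi_n\in\mathfrak{S}_n$, the permutation graph $G_\pi$ has vertex set $[n]=\{1,\ldots,n\}$ and an edge $\{\pi_i,\pi_j\}$ whenever $i<j$ and $\pi_i>\pi_j$ (i.e. $a<b$ are adjacent iff $b$ appears before $a$ in $\pi$). $\pi$ is indecomposable if there is no $k<n$ with $\{\pi_1,\ldots,\pi_k\}=[k]$ (equivalently $G_\pi$ is connected). Abelian sandpile model on a connected graph $G$ on $[n]$ with sink $s$: a configuration is $c\in\mathbb{Z}_{\ge0}^n$; $d_i$ is the degree of $i$; vertex $i$ is stable if $c_i<d_i$, unstable otherwise; toppling an unstable vertex $i$ subtracts $d_i$ from $c_i$ and adds $1$ to $c_j$ for each neighbour $j$ of $i$. A configuration $c$ is recurrent if $c_s=d_s$, $c_i<d_i$ for all $i\ne s$, and there is an ordering $v_1=s,v_2,\ldots,v_n$ of all vertices such that starting from $c$ one can successively topple $v_1,\ldots,v_n$ (each being unstable when toppled). $\mathrm{Rec}_s(G)$ is the set of recurrent configurations. The level is $\mathrm{level}(c)=\sum_i c_i-|E(G)|$. The canonical toppling of $c\in\mathrm{Rec}_s(G)$ is the ordered set partition $P_0,P_1,\ldots,P_k$ of $[n]$ with $P_0=\{s\}$ and, for $i\ge1$, $P_i$ the set of non-sink unstable vertices obtained from $c$ after toppling all vertices of $P_0,\ldots,P_{i-1}$. For a spanning tree $T$ rooted at $s$: $h(i)$ is the distance from $i$ to $s$ in $T$; for $i\ne s$, $p(i)$ is the parent of $i$ (next vertex on the path from $i$ to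 $s$); $T^{(k)}=\{i:h(i)=k\}$, similarly $T^{(>k)}$ etc.; $N_G(i)$ is the set of neighbours of $i$ in $G$. Define $\lambda_i(T)=|N_G(i)\cap T^{(>h(i))}|$, $\mu_i(T)=|N_G(i)\cap T^{(h(i))}|$, and for $i\ne s$, $\nu_i(T)=|\{j\in N_G(i)\cap T^{(h(i)-1)}: j<p(i)\}|$, with $\nu_s(T)=0$. -}

module Defs where

open import Data.Nat using (ℕ; zero; suc; _+_; _*_; _∸_; _≤_; _<_; _<ᵇ_; _≡ᵇ_)
open import Data.Bool using (Bool; true; false; _∧_; _∨_; not; if_then_else_)
open import Data.Fin using (Fin; toℕ) renaming (zero to fz; suc to fs)
open import Data.Fin.Permutation using (Permutation′; _⟨$⟩ʳ_; _⟨$⟩ˡ_)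
open import Data.List using (List; []; _∷_)
open import Data.List.Relation.Binary.Permutation.Propositional using (_↭_)
open import Data.Fin using (_≟_)
open import Data.List using (allFin)
open import Data.Product using (Σ; _×_; ∃)
open import Data.Unit using (⊤)
open import Data.Integer using (ℤ) renaming (_-_ to _-ℤ_; +_ to ℤ+)
open import Relation.Nullary using (¬_; does)
open import Relation.Binary.PropositionalEquality using (_≡_; _≢_)

-- Conventions: vertices [n] = {1..n} are represented by Fin n
-- (vertex k+1 ↦ k, order preserved).  Positions 1..n likewise.
-- A permutation π = π₁⋯πₙ is a Permutation′ n with π ⟨$⟩ʳ i = π_{i+1}.

count : ∀ {n} → (Fin n → Bool) → ℕ
count {zero}  f = 0
count {suc n} f = (if f fz then 1 else 0) + count (λ i → f (fs i))

Σᶠ : ∀ {n} → (Fin n → ℕ) → ℕ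
Σᶠ {zero}  f = 0
Σᶠ {suc n} f = f fz + Σᶠ (λ i → f (fs i))

_==_ : ∀ {n} → Fin n → Fin n → Bool
i == j = does (i ≟ j)

_<ᶠ_ : ∀ {n} → Fin n → Fin n → Bool
i <ᶠ j = toℕ i <ᵇ toℕ j

pos : ∀ {n} → Permutation′ n → Fin n → Fin n
pos π v = π ⟨$⟩ˡ v

Indecomposable : ∀ {n} → Permutation′ n → Set
Indecomposable {n} π =
  ∀ (k : ℕ) → 1 ≤ k → k < n →
    ¬ ( (∀ (i : Fin n) → toℕ i < k → toℕ (π ⟨$⟩ʳ i) < k)
      × (∀ (v : Fin n) → toℕ v < k → Σ (Fin n) (λ i → toℕ i < k × π ⟨$⟩ʳ i ≡ v)) )

adj : ∀ {n} → Permutation′ n → Fin n → Fin n → Bool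
adj π a b = (a <ᶠ b ∧ pos π b <ᶠ pos π a) ∨ (b <ᶠ a ∧ pos π a <ᶠ pos π b)

deg : ∀ {n} → Permutation′ n → Fin n → ℕ
deg π i = count (adj π i)

numEdges : ∀ {n} → Permutation′ n → ℕ
numEdges π = Σᶠ (λ a → count (λ b → a <ᶠ b ∧ adj π a b))

Config : ℕ → Set
Config n = Fin n → ℕ

topple : ∀ {n} → Permutation′ n → Config n → Fin n → Config n
topple π c i j =
  if j == i then c j ∸ deg π i
  else (if adj π i j then suc (c j) else c j)

LegalSeq : ∀ {n} → Permutation′ n → Config n → List (Fin n) → Set
LegalSeq π c []       = ⊤
LegalSeq π c (v ∷ vs) = deg π v ≤ c v × LegalSeq π (topple π c v) vs

Recurrent : ∀ {n} → Permutation′ n → Fin n → Config n → Set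
Recurrent {n} π s c =
    c s ≡ deg π s
  × (∀ i → i ≢ s → c i < deg π i)
  × Σ (List (Fin n)) (λ rest → ((s ∷ rest) ↭ allFin n) × LegalSeq π c (s ∷ rest))

level : ∀ {n} → Permutation′ n → Config n → ℤ
level π c = ℤ+ (Σᶠ c) -ℤ ℤ+ (numEdges π)

toppleSet : ∀ {n} → Permutation′ n → Config n → (Fin n → Bool) → Config n
toppleSet π c S j =
  (c j + count (λ i → S i ∧ adj π i j)) ∸ (if S j then deg π j else 0)

-- canonical toppling: (configuration before stage k, set P_k)
canonical-step : ∀ {n} → Permutation′ n → Fin n → Config n → ℕ → Config n × (Fin n → Bool)
canonical-step π s c zero = c Data.Product., (λ i → i == s)
canonical-step π s c (suc k) with canonical-step π s c k
... | (c' Data.Product., P) =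
  let c'' = toppleSet π c' P in
  c'' Data.Product., (λ i → not (i == s) ∧ (deg π i <ᵇ suc (c'' i)))

canonical : ∀ {n} → Permutation′ n → Fin n → Config n → ℕ → Fin n → Bool
canonical π s c k = Data.Product.proj₂ (canonical-step π s c k)

-- Spanning trees of G_π rooted at s, given by their parent map
-- (convention: par s = s).

iter : ∀ {n} → (Fin n → Fin n) → ℕ → Fin n → Fin n
iter f zero    i = i
iter f (suc k) i = f (iter f k i)

IsSpanningTree : ∀ {n} → Permutation′ n → Fin n → (Fin n → Fin n) → Set
IsSpanningTree {n} π s par =
    par s ≡ s
  × (∀ i → i ≢ s → adj π i (par i) ≡ true)
  × (∀ i → iter par n i ≡ s)                  -- every parent path reaches the root (acyclic)

-- number of steps along the parent path from i to s (fuel n suffices)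
heightF : ∀ {n} → Fin n → (Fin n → Fin n) → ℕ → Fin n → ℕ
heightF s par zero    i = 0
heightF s par (suc f) i = if i == s then 0 else suc (heightF s par f (par i))

height : ∀ {n} → Fin n → (Fin n → Fin n) → Fin n → ℕ
height {n} s par = heightF s par n

module _ {n} (π : Permutation′ n) (s : Fin n) (par : Fin n → Fin n) where
  private h = height s par

  lam : Fin n → ℕ
  lam i = count (λ j → adj π i j ∧ (h i <ᵇ h j))

  mu : Fin n → ℕ
  mu i = count (λ j → adj π i j ∧ (h j ≡ᵇ h i))

  nu : Fin n → ℕ
  nu i = if i == s then 0
         else count (λ j → adj π i j ∧ (suc (h j) ≡ᵇ h i) ∧ (j <ᶠ par i))

  treeConfig : Config n
  treeConfig i = lam i + mu i + nu i

-- Let h be the height function of T. Splitting the neighbours of i by height gives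
-- deg i = λ_i + μ_i + #(neighbours below i), while 0 ≤ ν_i < #(neighbours one level below i)
-- because ν_i counts the candidate parents smaller than p(i). So c(T) is stable off the sink, and
-- a vertex becomes unstable exactly when all its lower neighbours have toppled: the canonical
-- toppling of c(T) is the layering of T by height, and toppling by increasing height is legal.
-- Conversely, let c be recurrent and let layer v be the stage at which v topples canonically. Being
-- stable before that stage and unstable at it pins c v between λ + μ and λ + μ + #(candidates), so
-- c v − λ − μ is the rank ν of a unique candidate parent; these parents form a spanning tree whose
-- heights are the layers and whose configuration is c. The same reading recovers T from c(T).
-- The level formula is the handshake lemma together with Σ λ = Σ #(neighbours below).

module Submission where

open import Defs
open import Data.Nat using (ℕ; _+_; _*_; _≡ᵇ_)
open import Data.Integer using (ℤ) renaming (_*_ to _*ℤ_; +_ to ℤ+)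
open import Data.Fin using (Fin)
open import Data.Fin.Permutation using (Permutation′)
open import Data.Product using (Σ; _×_)
open import Relation.Binary.PropositionalEquality using (_≡_; _≗_)

open import Data.Bool using (Bool; true; false; _∧_; _∨_; not; if_then_else_; T)
import Data.Bool.Properties as BP
open import Data.Empty using (⊥-elim)
open import Data.Fin as F using (toℕ) renaming (zero to fz; suc to fs)
import Data.Fin.Properties as FP
import Data.Integer as Z
import Data.Integer.Properties as ZP
import Data.Integer.Tactic.RingSolver as ZRing
open import Data.List using (List; []; _∷_; allFin)
open import Data.List.Membership.Propositional using (_∈_)
open import Data.List.Membership.Propositional.Properties using (∈-allFin)
open import Data.List.Relation.Binary.Permutation.Propositional using (_↭_; ↭-sym; ↭⇒↭ₛ)
open import Data.List.Relation.Binary.Permutation.Propositional.Properties using (All-resp-↭; ∈-resp-↭)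
import Data.List.Relation.Binary.Permutation.Setoid.Properties as PermSetoid
open import Data.List.Relation.Unary.All as All using (All; []; _∷_)
open import Data.List.Relation.Unary.AllPairs using (AllPairs; []; _∷_)
open import Data.List.Relation.Unary.Any using (here; there)
open import Data.List.Relation.Unary.Sorted.TotalOrder.Properties using (Sorted⇒AllPairs)
open import Data.List.Relation.Unary.Unique.Propositional using (Unique)
open import Data.List.Relation.Unary.Unique.Propositional.Properties using (allFin⁺)
import Data.List.Sort as Sort
open import Data.Nat as N using (zero; suc; _∸_; _≤_; _<_; _<ᵇ_; z≤n; s≤s)
import Data.Nat.Properties as NP
open import Data.Nat.Tactic.RingSolver using (solve-∀)
open import Data.Product using (_,_; proj₁; proj₂)
open import Data.Unit using (tt)
import Relation.Binary.Construct.On as On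
open import Relation.Binary.Bundles using (DecTotalOrder)
open import Relation.Binary.Definitions using (tri<; tri≈; tri>)
open import Relation.Binary.PropositionalEquality
  using (refl; sym; trans; cong; cong₂; subst; _≢_; setoid; module ≡-Reasoning)
open import Relation.Nullary using (¬_; yes; no; Dec)
open import Relation.Nullary.Decidable using (dec-true; dec-false)

true≢false : true ≢ false
true≢false ()

∧-true⁻ˡ : ∀ {a b} → a ∧ b ≡ true → a ≡ true
∧-true⁻ˡ {true} _ = refl

∧-true⁻ʳ : ∀ {a b} → a ∧ b ≡ true → b ≡ true
∧-true⁻ʳ {true} p = p

∧-true⁺ : ∀ {a b} → a ≡ true → b ≡ true → a ∧ b ≡ true
∧-true⁺ refl refl = refl

∨-false⁻ : ∀ {a b} → a ∨ b ≡ false → a ≡ false × b ≡ false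
∨-false⁻ {false} e = refl , e

T⇒≡true : ∀ {b} → T b → b ≡ true
T⇒≡true {true} _ = refl

≡true⇒T : ∀ {b} → b ≡ true → T b
≡true⇒T refl = tt

<⇒<ᵇ≡true : ∀ {m n} → m < n → (m <ᵇ n) ≡ true
<⇒<ᵇ≡true p = T⇒≡true (NP.<⇒<ᵇ p)

<ᵇ≡true⇒< : ∀ {m n} → (m <ᵇ n) ≡ true → m < n
<ᵇ≡true⇒< {m} {n} p = NP.<ᵇ⇒< m n (≡true⇒T p)

≮⇒<ᵇ≡false : ∀ {m n} → ¬ m < n → (m <ᵇ n) ≡ false
≮⇒<ᵇ≡false {m} {n} m≮n with m <ᵇ n in eq
... | true  = ⊥-elim (m≮n (<ᵇ≡true⇒< eq))
... | false = refl

≡⇒≡ᵇ≡true : ∀ {m n} → m ≡ n → (m ≡ᵇ n) ≡ true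
≡⇒≡ᵇ≡true {m} {n} p = T⇒≡true (NP.≡⇒≡ᵇ m n p)

≡ᵇ≡true⇒≡ : ∀ {m n} → (m ≡ᵇ n) ≡ true → m ≡ n
≡ᵇ≡true⇒≡ {m} {n} p = NP.≡ᵇ⇒≡ m n (≡true⇒T p)

≢⇒≡ᵇ≡false : ∀ {m n} → m ≢ n → (m ≡ᵇ n) ≡ false
≢⇒≡ᵇ≡false {m} {n} m≢n with m ≡ᵇ n in eq
... | true  = ⊥-elim (m≢n (≡ᵇ≡true⇒≡ eq))
... | false = refl

n<ᵇn≡false : ∀ n → (n <ᵇ n) ≡ false
n<ᵇn≡false n = ≮⇒<ᵇ≡false {n} {n} (NP.<-irrefl refl)

≡⇒==≡true : ∀ {n} {i j : Fin n} → i ≡ j → (i == j) ≡ true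
≡⇒==≡true {i = i} {j} = dec-true (i F.≟ j)

≢⇒==≡false : ∀ {n} {i j : Fin n} → i ≢ j → (i == j) ≡ false
≢⇒==≡false {i = i} {j} = dec-false (i F.≟ j)

==≡true⇒≡ : ∀ {n} {i j : Fin n} → (i == j) ≡ true → i ≡ j
==≡true⇒≡ {i = i} {j} p with i F.≟ j
... | yes i≡j = i≡j

not-<ᵇ∧≡ᵇ : ∀ x y → not (x <ᵇ y) ∧ (y ≡ᵇ x) ≡ (y ≡ᵇ x)
not-<ᵇ∧≡ᵇ x y with NP.<-cmp x y
... | tri< x<y _ _ rewrite <⇒<ᵇ≡true x<y | ≢⇒≡ᵇ≡false {y} {x} (λ e → NP.<-irrefl (sym e) x<y) = refl
... | tri≈ _ x≡y _ rewrite ≮⇒<ᵇ≡false {x} {y} (NP.<-irrefl x≡y) = refl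
... | tri> _ _ y<x rewrite ≮⇒<ᵇ≡false {x} {y} (NP.<-asym y<x) = refl

not-<ᵇ∧not-≡ᵇ : ∀ x y → not (x <ᵇ y) ∧ not (y ≡ᵇ x) ≡ (y <ᵇ x)
not-<ᵇ∧not-≡ᵇ x y with NP.<-cmp x y
... | tri< x<y _ _ rewrite <⇒<ᵇ≡true x<y | ≮⇒<ᵇ≡false {y} {x} (NP.<-asym x<y) = refl
... | tri≈ _ refl _ rewrite n<ᵇn≡false x | ≡⇒≡ᵇ≡true {x} refl = refl
... | tri> _ _ y<x rewrite ≮⇒<ᵇ≡false {x} {y} (NP.<-asym y<x)
                         | ≢⇒≡ᵇ≡false {y} {x} (λ e → NP.<-irrefl e y<x) | <⇒<ᵇ≡true y<x = refl

<ᵇ∧1+≡ᵇ : ∀ x y → (x <ᵇ y) ∧ (suc x ≡ᵇ y) ≡ (suc x ≡ᵇ y)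
<ᵇ∧1+≡ᵇ x y with suc x ≡ᵇ y in e
... | true rewrite sym (≡ᵇ≡true⇒≡ {suc x} {y} e) | <⇒<ᵇ≡true (NP.n<1+n x) = refl
... | false = BP.∧-zeroʳ (x <ᵇ y)

<ᵇ1+∧not-≡ᵇ : ∀ x k → (x <ᵇ suc k) ∧ not (x ≡ᵇ k) ≡ (x <ᵇ k)
<ᵇ1+∧not-≡ᵇ x k with NP.<-cmp x k
... | tri< x<k _ _ rewrite <⇒<ᵇ≡true x<k | <⇒<ᵇ≡true (NP.m<n⇒m<1+n x<k)
                        | ≢⇒≡ᵇ≡false {x} {k} (λ e → NP.<-irrefl e x<k) = refl
... | tri≈ _ refl _ rewrite n<ᵇn≡false x | ≡⇒≡ᵇ≡true {x} refl = BP.∧-zeroʳ _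
... | tri> _ _ k<x rewrite ≮⇒<ᵇ≡false {x} {k} (NP.<-asym k<x)
                         | ≮⇒<ᵇ≡false {x} {suc k} (λ x<1+k → NP.<-irrefl refl (NP.<-≤-trans k<x (NP.≤-pred x<1+k))) = refl

<ᵇ∨≡ᵇ : ∀ x k → (x <ᵇ k) ∨ (x ≡ᵇ k) ≡ (x <ᵇ suc k)
<ᵇ∨≡ᵇ x k with NP.<-cmp x k
... | tri< x<k _ _ rewrite <⇒<ᵇ≡true x<k | <⇒<ᵇ≡true (NP.m<n⇒m<1+n x<k) = refl
... | tri≈ _ refl _ rewrite n<ᵇn≡false x | ≡⇒≡ᵇ≡true {x} refl | <⇒<ᵇ≡true (NP.n<1+n x) = refl
... | tri> _ _ k<x rewrite ≮⇒<ᵇ≡false {x} {k} (NP.<-asym k<x) | ≢⇒≡ᵇ≡false {x} {k} (λ e → NP.<-irrefl (sym e) k<x)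
                         | ≮⇒<ᵇ≡false {x} {suc k} (λ x<1+k → NP.<-irrefl refl (NP.<-≤-trans k<x (NP.≤-pred x<1+k))) = refl

2*[m-n]≡k : ∀ m n k → m + m ≡ (n + n) + k → ℤ+ 2 *ℤ (ℤ+ m Z.- ℤ+ n) ≡ ℤ+ k
2*[m-n]≡k m n k eq = begin
    ℤ+ 2 *ℤ (ℤ+ m Z.- ℤ+ n)              ≡⟨ double (ℤ+ m) (ℤ+ n) ⟩
    (ℤ+ m Z.+ ℤ+ m) Z.- (ℤ+ n Z.+ ℤ+ n)  ≡⟨ cong₂ Z._-_ (sym (ZP.pos-+ m m)) (sym (ZP.pos-+ n n)) ⟩
    ℤ+ (m + m) Z.- ℤ+ (n + n)            ≡⟨ cong (λ z → ℤ+ z Z.- ℤ+ (n + n)) eq ⟩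
    ℤ+ ((n + n) + k) Z.- ℤ+ (n + n)      ≡⟨ cong (Z._- ℤ+ (n + n)) (ZP.pos-+ (n + n) k) ⟩
    (ℤ+ (n + n) Z.+ ℤ+ k) Z.- ℤ+ (n + n) ≡⟨ cancel (ℤ+ (n + n)) (ℤ+ k) ⟩
    ℤ+ k                                 ∎
  where
  open ≡-Reasoning
  double : ∀ a b → ℤ+ 2 *ℤ (a Z.- b) ≡ (a Z.+ a) Z.- (b Z.+ b)
  double = ZRing.solve-∀
  cancel : ∀ a b → (a Z.+ b) Z.- a ≡ b
  cancel = ZRing.solve-∀

-- Counting over Fin n

_⊆ᵇ_ : ∀ {n} → (Fin n → Bool) → (Fin n → Bool) → Set
f ⊆ᵇ g = ∀ x → f x ≡ true → g x ≡ true

count-cong : ∀ {n} {f g : Fin n → Bool} → f ≗ g → count f ≡ count g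
count-cong {zero}  e = refl
count-cong {suc n} e rewrite e fz = cong (_ +_) (count-cong (λ i → e (fs i)))

count-none : ∀ {n} → count {n} (λ _ → false) ≡ 0
count-none {zero}  = refl
count-none {suc n} = count-none {n}

count≤n : ∀ {n} (f : Fin n → Bool) → count f ≤ n
count≤n {zero}  f = z≤n
count≤n {suc n} f with f fz
... | true  = s≤s (count≤n (λ i → f (fs i)))
... | false = NP.m≤n⇒m≤1+n (count≤n (λ i → f (fs i)))

count-mono : ∀ {n} {f g : Fin n → Bool} → f ⊆ᵇ g → count f ≤ count g
count-mono {zero}  f⊆g = z≤n
count-mono {suc n} {f} {g} f⊆g with f fz in ef | g fz in eg
... | true  | true  = s≤s (count-mono (λ x → f⊆g (fs x)))
... | true  | false = ⊥-elim (true≢false (trans (sym (f⊆g fz ef)) eg))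
... | false | true  = NP.m≤n⇒m≤1+n (count-mono (λ x → f⊆g (fs x)))
... | false | false = count-mono (λ x → f⊆g (fs x))

count-mono-< : ∀ {n} {f g : Fin n → Bool} → f ⊆ᵇ g → (p : Fin n) → f p ≡ false → g p ≡ true →
               count f < count g
count-mono-< {suc n} f⊆g fz fp gp rewrite fp | gp = s≤s (count-mono (λ x → f⊆g (fs x)))
count-mono-< {suc n} {f} {g} f⊆g (fs p) fp gp with f fz in ef | g fz in eg
... | true  | true  = s≤s (count-mono-< (λ x → f⊆g (fs x)) p fp gp)
... | true  | false = ⊥-elim (true≢false (trans (sym (f⊆g fz ef)) eg))
... | false | true  = NP.m≤n⇒m≤1+n (count-mono-< (λ x → f⊆g (fs x)) p fp gp)
... | false | false = count-mono-< (λ x → f⊆g (fs x)) p fp gp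

count-∧-split : ∀ {n} (f g : Fin n → Bool) →
                count f ≡ count (λ x → f x ∧ g x) + count (λ x → f x ∧ not (g x))
count-∧-split {zero}  f g = refl
count-∧-split {suc n} f g with f fz | g fz | count-∧-split (λ x → f (fs x)) (λ x → g (fs x))
... | true  | true  | ih = cong suc ih
... | true  | false | ih = trans (cong suc ih) (sym (NP.+-suc _ _))
... | false | true  | ih = ih
... | false | false | ih = ih

count-∨-disjoint : ∀ {n} (f g : Fin n → Bool) → (∀ x → f x ∧ g x ≡ false) →
                   count (λ x → f x ∨ g x) ≡ count f + count g
count-∨-disjoint {zero}  f g d = refl
count-∨-disjoint {suc n} f g d
  with f fz | g fz | d fz | count-∨-disjoint (λ x → f (fs x)) (λ x → g (fs x)) (λ x → d (fs x))
... | true  | false | _ | ih = cong suc ih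
... | false | true  | _ | ih = trans (cong suc ih) (sym (NP.+-suc _ _))
... | false | false | _ | ih = ih

count-==∧ : ∀ {n} (a : Fin n → Bool) (v : Fin n) →
            count (λ x → (x == v) ∧ a x) ≡ (if a v then 1 else 0)
count-==∧ {suc n} a fz     = trans (cong ((if a fz then 1 else 0) +_) (count-none {n})) (NP.+-identityʳ _)
count-==∧ {suc n} a (fs v) = count-==∧ (λ x → a (fs x)) v

Σᶠ-cong : ∀ {n} {f g : Fin n → ℕ} → f ≗ g → Σᶠ f ≡ Σᶠ g
Σᶠ-cong {zero}  e = refl
Σᶠ-cong {suc n} e = cong₂ _+_ (e fz) (Σᶠ-cong (λ i → e (fs i)))

Σᶠ-zero : ∀ n → Σᶠ {n} (λ _ → 0) ≡ 0
Σᶠ-zero zero    = refl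
Σᶠ-zero (suc n) = Σᶠ-zero n

Σᶠ-+ : ∀ {n} (f g : Fin n → ℕ) → Σᶠ (λ i → f i + g i) ≡ Σᶠ f + Σᶠ g
Σᶠ-+ {zero}  f g = refl
Σᶠ-+ {suc n} f g rewrite Σᶠ-+ (λ i → f (fs i)) (λ i → g (fs i)) = interchange (f fz) (g fz) _ _
  where
  interchange : ∀ a b c d → (a + b) + (c + d) ≡ (a + c) + (b + d)
  interchange = solve-∀

Σᶠ-*ˡ : ∀ {n} m (f : Fin n → ℕ) → Σᶠ (λ i → m * f i) ≡ m * Σᶠ f
Σᶠ-*ˡ {zero}  m f = sym (NP.*-zeroʳ m)
Σᶠ-*ˡ {suc n} m f rewrite Σᶠ-*ˡ m (λ i → f (fs i)) = sym (NP.*-distribˡ-+ m (f fz) _)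

Σᶠ-indicator : ∀ {n} (b : Fin n → Bool) → Σᶠ (λ i → if b i then 1 else 0) ≡ count b
Σᶠ-indicator {zero}  b = refl
Σᶠ-indicator {suc n} b = cong ((if b fz then 1 else 0) +_) (Σᶠ-indicator (λ i → b (fs i)))

Σᶠ-count-comm : ∀ {m k} (R : Fin m → Fin k → Bool) →
                Σᶠ (λ i → count (R i)) ≡ Σᶠ (λ j → count (λ i → R i j))
Σᶠ-count-comm {zero}  {k} R = sym (Σᶠ-zero k)
Σᶠ-count-comm {suc m} {k} R = begin
    count (R fz) + Σᶠ (λ i → count (R (fs i)))
  ≡⟨ cong₂ _+_ (sym (Σᶠ-indicator (R fz))) (Σᶠ-count-comm (λ i → R (fs i))) ⟩
    Σᶠ (λ j → if R fz j then 1 else 0) + Σᶠ (λ j → count (λ i → R (fs i) j))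
  ≡⟨ sym (Σᶠ-+ (λ j → if R fz j then 1 else 0) (λ j → count (λ i → R (fs i) j))) ⟩
    Σᶠ (λ j → count (λ i → R i j)) ∎
  where open ≡-Reasoning

rank : ∀ {n} → (Fin n → Bool) → Fin n → ℕ
rank B j = count (λ i → B i ∧ (i <ᶠ j))

rank-surjective : ∀ {n} (B : Fin n → Bool) r → r < count B →
                  Σ (Fin n) (λ j → B j ≡ true × rank B j ≡ r)
rank-surjective {suc n} B r r<B with B fz in e
rank-surjective {suc n} B zero _ | true =
  fz , e , trans (count-cong (λ i → BP.∧-zeroʳ (B (fs i)))) (count-none {n})
rank-surjective {suc n} B (suc r) r<B | true with rank-surjective (λ i → B (fs i)) r (NP.≤-pred r<B)
... | j , Bj , rank≡r = fs j , Bj , cong suc rank≡r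
rank-surjective {suc n} B r r<B | false with rank-surjective (λ i → B (fs i)) r r<B
... | j , Bj , rank≡r = fs j , Bj , rank≡r

rank-< : ∀ {n} (B : Fin n → Bool) {p q : Fin n} → B p ≡ true → toℕ p < toℕ q → rank B p < rank B q
rank-< B {p} {q} Bp p<q = count-mono-< below-p⊆below-q p p-not-below-p p-below-q
  where
  below-p⊆below-q : (λ j → B j ∧ (j <ᶠ p)) ⊆ᵇ (λ j → B j ∧ (j <ᶠ q))
  below-p⊆below-q j e =
    ∧-true⁺ {B j} (∧-true⁻ˡ {B j} e) (<⇒<ᵇ≡true (NP.<-trans (<ᵇ≡true⇒< (∧-true⁻ʳ {B j} e)) p<q))
  p-not-below-p : B p ∧ (p <ᶠ p) ≡ false
  p-not-below-p rewrite n<ᵇn≡false (toℕ p) = BP.∧-zeroʳ (B p)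
  p-below-q : B p ∧ (p <ᶠ q) ≡ true
  p-below-q rewrite Bp = <⇒<ᵇ≡true p<q

rank-injective : ∀ {n} (B : Fin n → Bool) {p q : Fin n} → B p ≡ true → B q ≡ true →
                 rank B p ≡ rank B q → p ≡ q
rank-injective B {p} {q} Bp Bq e with NP.<-cmp (toℕ p) (toℕ q)
... | tri< p<q _ _ = ⊥-elim (NP.<-irrefl e (rank-< B Bp p<q))
... | tri≈ _ p≡q _ = FP.toℕ-injective p≡q
... | tri> _ _ q<p = ⊥-elim (NP.<-irrefl (sym e) (rank-< B Bq q<p))

iter-suc : ∀ {n} (f : Fin n → Fin n) k i → iter f (suc k) i ≡ iter f k (f i)
iter-suc f zero    i = refl
iter-suc f (suc k) i = cong f (iter-suc f k i)

iter-fixed : ∀ {n} (f : Fin n → Fin n) {s} → f s ≡ s → ∀ k → iter f k s ≡ s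
iter-fixed f e zero    = refl
iter-fixed f e (suc k) = trans (cong f (iter-fixed f e k)) e

heightF-stable : ∀ {n} (s : Fin n) (par : Fin n → Fin n) f i → iter par f i ≡ s → ∀ m →
                 heightF s par (f + m) i ≡ heightF s par f i
heightF-stable s par zero i refl zero = refl
heightF-stable s par zero i refl (suc m) rewrite ≡⇒==≡true {i = i} refl = refl
heightF-stable s par (suc f) i e m with i == s
... | true  = refl
... | false = cong suc (heightF-stable s par f (par i) (trans (sym (iter-suc par f i)) e) m)

height-root : ∀ {n} (s : Fin n) par → height s par s ≡ 0
height-root {suc n} s par rewrite ≡⇒==≡true {i = s} refl = refl

height≡0⇒root : ∀ {n} (s : Fin n) par {i} → height s par i ≡ 0 → i ≡ s
height≡0⇒root {suc n} s par {i} e with i F.≟ s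
... | yes i≡s = i≡s
... | no  _   = ⊥-elim (NP.0≢1+n (sym e))

height-parent : ∀ {n} (s : Fin n) par → (∀ i → iter par n i ≡ s) → ∀ {i} → i ≢ s →
                height s par i ≡ suc (height s par (par i))
height-parent {suc n} s par reaches {i} i≢s rewrite ≢⇒==≡false i≢s =
  cong suc (sym (trans (cong (λ m → heightF s par m (par i)) (NP.+-comm 1 n))
    (heightF-stable s par n (par i) (trans (sym (iter-suc par n i)) (reaches i)) 1)))

-- The permutation graph

module _ {n} (π : Permutation′ n) where

  adj-sym : ∀ a b → adj π a b ≡ adj π b a
  adj-sym a b = BP.∨-comm ((a <ᶠ b) ∧ (pos π b <ᶠ pos π a)) ((b <ᶠ a) ∧ (pos π a <ᶠ pos π b))

  adj-irrefl : ∀ a → adj π a a ≡ false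
  adj-irrefl a rewrite n<ᵇn≡false (toℕ a) = refl

  adj⇒≢ : ∀ {a b} → adj π a b ≡ true → a ≢ b
  adj⇒≢ {a} e refl = true≢false (trans (sym e) (adj-irrefl a))

  deg-split : (g : Fin n → ℕ) → ∀ i → deg π i ≡
      count (λ j → adj π i j ∧ (g i <ᵇ g j)) + count (λ j → adj π i j ∧ (g j ≡ᵇ g i))
      + count (λ j → adj π i j ∧ (g j <ᵇ g i))
  deg-split g i = begin
      count (adj π i)
    ≡⟨ count-∧-split (adj π i) (λ j → g i <ᵇ g j) ⟩
      count above + count (λ j → adj π i j ∧ not (g i <ᵇ g j))
    ≡⟨ cong (count above +_) (count-∧-split _ (λ j → g j ≡ᵇ g i)) ⟩
      count above + (count (λ j → (adj π i j ∧ not (g i <ᵇ g j)) ∧ (g j ≡ᵇ g i))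
                     + count (λ j → (adj π i j ∧ not (g i <ᵇ g j)) ∧ not (g j ≡ᵇ g i)))
    ≡⟨ cong (count above +_) (cong₂ _+_
         (count-cong (λ j → trans (BP.∧-assoc (adj π i j) _ _) (cong (adj π i j ∧_) (not-<ᵇ∧≡ᵇ (g i) (g j)))))
         (count-cong (λ j → trans (BP.∧-assoc (adj π i j) _ _) (cong (adj π i j ∧_) (not-<ᵇ∧not-≡ᵇ (g i) (g j)))))) ⟩
      count above + (count (λ j → adj π i j ∧ (g j ≡ᵇ g i)) + count (λ j → adj π i j ∧ (g j <ᵇ g i)))
    ≡⟨ sym (NP.+-assoc (count above) _ _) ⟩
      _ ∎
    where
    open ≡-Reasoning
    above : Fin n → Bool
    above j = adj π i j ∧ (g i <ᵇ g j)

  private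
    not-<ᶠ-adj : ∀ {a b} → adj π a b ≡ true → not (a <ᶠ b) ≡ (b <ᶠ a)
    not-<ᶠ-adj {a} {b} e = trans (sym (BP.∧-identityʳ _))
      (trans (cong (λ x → not (a <ᶠ b) ∧ not x)
                   (sym (≢⇒≡ᵇ≡false (λ q → adj⇒≢ {a} {b} e (sym (FP.toℕ-injective q))))))
        (not-<ᵇ∧not-≡ᵇ (toℕ a) (toℕ b)))

  handshake : Σᶠ (deg π) ≡ numEdges π + numEdges π
  handshake = begin
      Σᶠ (deg π)
    ≡⟨ Σᶠ-cong (λ a → count-∧-split (adj π a) (λ b → a <ᶠ b)) ⟩
      Σᶠ (λ a → count (λ b → adj π a b ∧ (a <ᶠ b)) + count (λ b → adj π a b ∧ not (a <ᶠ b)))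
    ≡⟨ Σᶠ-+ (λ a → count (λ b → adj π a b ∧ (a <ᶠ b))) (λ a → count (λ b → adj π a b ∧ not (a <ᶠ b))) ⟩
      Σᶠ (λ a → count (λ b → adj π a b ∧ (a <ᶠ b))) + Σᶠ (λ a → count (λ b → adj π a b ∧ not (a <ᶠ b)))
    ≡⟨ cong₂ _+_ (Σᶠ-cong (λ a → count-cong (λ b → BP.∧-comm (adj π a b) _))) downward-edges ⟩
      numEdges π + numEdges π ∎
    where
    open ≡-Reasoning
    not-<ᶠ : ∀ a b → adj π a b ∧ not (a <ᶠ b) ≡ adj π a b ∧ (b <ᶠ a)
    not-<ᶠ a b with adj π a b in e
    ... | true  = not-<ᶠ-adj {a} {b} e
    ... | false = refl
    downward-edges : Σᶠ (λ a → count (λ b → adj π a b ∧ not (a <ᶠ b))) ≡ numEdges π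
    downward-edges = begin
        Σᶠ (λ a → count (λ b → adj π a b ∧ not (a <ᶠ b)))
      ≡⟨ Σᶠ-cong (λ a → count-cong (not-<ᶠ a)) ⟩
        Σᶠ (λ a → count (λ b → adj π a b ∧ (b <ᶠ a)))
      ≡⟨ Σᶠ-count-comm (λ a b → adj π a b ∧ (b <ᶠ a)) ⟩
        Σᶠ (λ b → count (λ a → adj π a b ∧ (b <ᶠ a)))
      ≡⟨ Σᶠ-cong (λ b → count-cong (λ a → trans (BP.∧-comm (adj π a b) _) (cong ((b <ᶠ a) ∧_) (adj-sym a b)))) ⟩
        numEdges π ∎

  received : (Fin n → Bool) → Fin n → ℕ
  received E j = count (λ i → E i ∧ adj π i j)

  received≤deg : ∀ E j → received E j ≤ deg π j
  received≤deg E j = count-mono (λ i e → trans (adj-sym j i) (∧-true⁻ʳ {E i} e))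

  -- c′ is what c becomes when each vertex of E topples once, stated without truncated subtraction.
  Toppled : Config n → (Fin n → Bool) → Config n → Set
  Toppled c E c′ = ∀ j → c′ j + (if E j then deg π j else 0) ≡ c j + received E j

  Toppled-none : ∀ c → Toppled c (λ _ → false) c
  Toppled-none c j =
    trans (NP.+-identityʳ (c j)) (sym (trans (cong (c j +_) (count-none {n})) (NP.+-identityʳ (c j))))

  Toppled-untoppled : ∀ {c E c′} → Toppled c E c′ → ∀ {j} → E j ≡ false → c′ j ≡ c j + received E j
  Toppled-untoppled {c} {E} {c′} t {j} Ej =
    trans (sym (NP.+-identityʳ (c′ j))) (trans (cong (λ b → c′ j + (if b then deg π j else 0)) (sym Ej)) (t j))

  private
    received-∪-single : ∀ E v → E v ≡ false → ∀ j →
      received (λ i → E i ∨ (i == v)) j ≡ received E j + (if adj π v j then 1 else 0)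
    received-∪-single E v Ev j =
      trans (count-cong (λ i → BP.∧-distribʳ-∨ (adj π i j) (E i) (i == v)))
        (trans (count-∨-disjoint _ _ disjoint) (cong (received E j +_) (count-==∧ (λ i → adj π i j) v)))
      where
      disjoint : ∀ i → (E i ∧ adj π i j) ∧ ((i == v) ∧ adj π i j) ≡ false
      disjoint i with i F.≟ v
      ... | yes refl rewrite Ev = refl
      ... | no  _    = BP.∧-zeroʳ _

  Toppled-topple : ∀ {c c′ E} v → Toppled c E c′ → E v ≡ false → deg π v ≤ c′ v →
                   Toppled c (λ i → E i ∨ (i == v)) (topple π c′ v)
  Toppled-topple {c} {c′} {E} v t Ev unstable j with j F.≟ v
  ... | yes refl rewrite Ev | received-∪-single E v Ev v | adj-irrefl v =
    trans (NP.m∸n+n≡m unstable)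
      (trans (Toppled-untoppled t Ev) (cong (c v +_) (sym (NP.+-identityʳ _))))
  ... | no j≢v rewrite BP.∨-identityʳ (E j) | received-∪-single E v Ev j with adj π v j
  ...   | true  = trans (cong suc (t j)) (trans (sym (NP.+-suc (c j) _)) (cong (c j +_) (NP.+-comm 1 _)))
  ...   | false = trans (t j) (cong (c j +_) (sym (NP.+-identityʳ _)))

  untoppled-after : ∀ {E : Fin n → Bool} {v : Fin n} {vs : List (Fin n)} →
                    All (λ w → E w ≡ false) vs → All (v ≢_) vs → All (λ w → E w ∨ (w == v) ≡ false) vs
  untoppled-after {E} {v} untoppled v∉vs =
    All.zipWith (λ {w} (Ew , v≢w) → subst (λ b → b ∨ (w == v) ≡ false) (sym Ew) (≢⇒==≡false (λ e → v≢w (sym e))))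
                (untoppled , v∉vs)

  -- Canonical toppling

  module Canonical (s : Fin n) (c : Config n) (sink-full : c s ≡ deg π s)
                   (stable : ∀ i → i ≢ s → c i < deg π i) where

    stage : ℕ → Config n
    stage k = proj₁ (canonical-step π s c k)

    block : ℕ → Fin n → Bool
    block = canonical π s c

    done : ℕ → Fin n → Bool
    done zero    _ = false
    done (suc k) i = done k i ∨ block k i

    inflow : ℕ → Fin n → ℕ
    inflow k = received (done k)

    record Invariant (k : ℕ) : Set where
      field
        toppled  : Toppled c (done k) (stage k)
        fresh    : ∀ j → block k j ≡ true → done k j ≡ false
        unstable : ∀ j → block k j ≡ true → deg π j ≤ stage k j

    block-suc⇒≢sink : ∀ {k j} → block (suc k) j ≡ true → j ≢ s
    block-suc⇒≢sink {k} {j} e j≡s = true≢false (trans (sym (∧-true⁻ˡ {not (j == s)} e)) (cong not (≡⇒==≡true j≡s)))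

    inflow-suc : ∀ k → (∀ j → block k j ≡ true → done k j ≡ false) → ∀ j →
                 inflow (suc k) j ≡ inflow k j + received (block k) j
    inflow-suc k fresh j =
      trans (count-cong (λ i → BP.∧-distribʳ-∨ (adj π i j) (done k i) (block k i))) (count-∨-disjoint _ _ disjoint)
      where
      disjoint : ∀ i → (done k i ∧ adj π i j) ∧ (block k i ∧ adj π i j) ≡ false
      disjoint i with block k i in e
      ... | false = BP.∧-zeroʳ _
      ... | true rewrite fresh i e = refl

    toppled-suc : ∀ {k} → Invariant k → Toppled c (done (suc k)) (stage (suc k))
    toppled-suc {k} I j with block k j in e
    ... | true rewrite Invariant.fresh I j e = begin
          (stage k j + Q ∸ deg π j) + deg π j  ≡⟨ NP.m∸n+n≡m (NP.≤-trans (unstable j e) (NP.m≤m+n _ Q)) ⟩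
          stage k j + Q                        ≡⟨ cong (_+ Q) (Toppled-untoppled toppled (fresh j e)) ⟩
          c j + inflow k j + Q                 ≡⟨ NP.+-assoc (c j) (inflow k j) Q ⟩
          c j + (inflow k j + Q)               ≡⟨ cong (c j +_) (sym (inflow-suc k fresh j)) ⟩
          c j + inflow (suc k) j               ∎
      where
      open ≡-Reasoning
      open Invariant I
      Q : ℕ
      Q = received (block k) j
    ... | false rewrite BP.∨-identityʳ (done k j) = begin
          (stage k j + Q) + D      ≡⟨ swap-last (stage k j) Q D ⟩
          (stage k j + D) + Q      ≡⟨ cong (_+ Q) (toppled j) ⟩
          c j + inflow k j + Q     ≡⟨ NP.+-assoc (c j) (inflow k j) Q ⟩
          c j + (inflow k j + Q)   ≡⟨ cong (c j +_) (sym (inflow-suc k fresh j)) ⟩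
          c j + inflow (suc k) j   ∎
      where
      open ≡-Reasoning
      open Invariant I
      Q : ℕ
      Q = received (block k) j
      D : ℕ
      D = if done k j then deg π j else 0
      swap-last : ∀ a b d → (a + b) + d ≡ (a + d) + b
      swap-last = solve-∀

    -- fresh: a vertex that had already toppled would now hold c j + inflow − deg < deg chips.
    invariant : ∀ k → Invariant k
    invariant zero = record
      { toppled  = Toppled-none c
      ; fresh    = λ _ _ → refl
      ; unstable = λ j e → subst (λ x → deg π x ≤ c x) (sym (==≡true⇒≡ e)) (NP.≤-reflexive (sym sink-full))
      }
    invariant (suc k) = record { toppled = toppled′ ; fresh = fresh′ ; unstable = unstable′ }
      where
      toppled′ : Toppled c (done (suc k)) (stage (suc k))
      toppled′ = toppled-suc (invariant k)
      unstable′ : ∀ j → block (suc k) j ≡ true → deg π j ≤ stage (suc k) j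
      unstable′ j e = NP.≤-pred (<ᵇ≡true⇒< {deg π j} (∧-true⁻ʳ {not (j == s)} e))
      fresh′ : ∀ j → block (suc k) j ≡ true → done (suc k) j ≡ false
      fresh′ j e with done (suc k) j in d
      ... | false = refl
      ... | true  = ⊥-elim (NP.<-irrefl refl (NP.≤-<-trans twice-deg≤ chips<twice-deg))
        where
        twice-deg≤ : deg π j + deg π j ≤ c j + inflow (suc k) j
        twice-deg≤ = NP.≤-trans (NP.+-monoˡ-≤ (deg π j) (unstable′ j e))
          (NP.≤-reflexive (trans (cong (λ b → stage (suc k) j + (if b then deg π j else 0)) (sym d)) (toppled′ j)))
        chips<twice-deg : c j + inflow (suc k) j < deg π j + deg π j
        chips<twice-deg = NP.+-mono-<-≤ (stable j (block-suc⇒≢sink {k} e)) (received≤deg (done (suc k)) j)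

    block-fresh : ∀ k j → block k j ≡ true → done k j ≡ false
    block-fresh k = Invariant.fresh (invariant k)

    stage-untoppled : ∀ k {j} → done k j ≡ false → stage k j ≡ c j + inflow k j
    stage-untoppled k = Toppled-untoppled (Invariant.toppled (invariant k))

    block-suc⁺ : ∀ k {j} → j ≢ s → done (suc k) j ≡ false → deg π j ≤ c j + inflow (suc k) j →
                 block (suc k) j ≡ true
    block-suc⁺ k {j} j≢s d le rewrite ≢⇒==≡false j≢s | stage-untoppled (suc k) d = <⇒<ᵇ≡true (s≤s le)

    block-suc⁻ : ∀ k {j} → block (suc k) j ≡ true → deg π j ≤ c j + inflow (suc k) j
    block-suc⁻ k {j} e =
      subst (deg π j ≤_) (stage-untoppled (suc k) (block-fresh (suc k) j e)) (Invariant.unstable (invariant (suc k)) j e)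

    block-stable : ∀ k {j} → j ≢ s → done k j ≡ false → block k j ≡ false → c j + inflow k j < deg π j
    block-stable zero    {j} j≢s _ _ rewrite count-none {n} = subst (_< deg π j) (sym (NP.+-identityʳ (c j))) (stable j j≢s)
    block-stable (suc k) {j} j≢s d b with c j + inflow (suc k) j NP.<? deg π j
    ... | yes lt = lt
    ... | no ¬lt = ⊥-elim (true≢false (trans (sym (block-suc⁺ k j≢s d (NP.≮⇒≥ ¬lt))) b))

    done-suc : ∀ k {i} → done k i ≡ true → done (suc k) i ≡ true
    done-suc k e rewrite e = refl

    done-mono : ∀ {k k′} i → k ≤ k′ → done k i ≡ true → done k′ i ≡ true
    done-mono {k} {k′} i k≤k′ e = subst (λ x → done x i ≡ true) (NP.m∸n+n≡m k≤k′) (go (k′ ∸ k))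
      where
      go : ∀ d → done (d + k) i ≡ true
      go zero    = e
      go (suc d) = done-suc (d + k) (go d)

    block⇒done-suc : ∀ k {i} → block k i ≡ true → done (suc k) i ≡ true
    block⇒done-suc k {i} e rewrite e = BP.∨-zeroʳ (done k i)

    sink-done : ∀ k → done (suc k) s ≡ true
    sink-done zero    = block⇒done-suc zero {s} (≡⇒==≡true {i = s} refl)
    sink-done (suc k) = done-suc (suc k) (sink-done k)

    unstable⇒done-suc : ∀ k {v} → deg π v ≤ c v + inflow k v → done (suc k) v ≡ true
    unstable⇒done-suc k {v} le with v F.≟ s
    ... | yes refl = sink-done k
    ... | no  v≢s  = from-block k le
      where
      from-block : ∀ k → deg π v ≤ c v + inflow k v → done (suc k) v ≡ true
      from-block zero le rewrite count-none {n} | NP.+-identityʳ (c v) =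
        ⊥-elim (NP.<-irrefl refl (NP.<-≤-trans (stable v v≢s) le))
      from-block (suc k) le with done (suc k) v in d
      ... | true  = refl
      ... | false = block-suc⁺ k v≢s d le

    inflow-by-key : (g : Fin n → ℕ) → ∀ k j → (∀ i → done k i ≡ (g i <ᵇ k)) →
                    inflow k j ≡ count (λ i → adj π j i ∧ (g i <ᵇ k))
    inflow-by-key g k j D = count-cong (λ i → trans (cong₂ _∧_ (D i) (adj-sym i j)) (BP.∧-comm (g i <ᵇ k) (adj π j i)))

  -- The configuration of a spanning tree

  module SpanningTree (s : Fin n) (par : Fin n → Fin n) (tree : IsSpanningTree π s par) where

    h : Fin n → ℕ
    h = height s par

    c : Config n
    c = treeConfig π s par

    h-root : h s ≡ 0
    h-root = height-root s par

    h≡0⇒root : ∀ {i} → h i ≡ 0 → i ≡ s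
    h≡0⇒root = height≡0⇒root s par

    h-parent : ∀ {i} → i ≢ s → h i ≡ suc (h (par i))
    h-parent = height-parent s par (proj₂ (proj₂ tree))

    parent-adj : ∀ {i} → i ≢ s → adj π i (par i) ≡ true
    parent-adj {i} = proj₁ (proj₂ tree) i

    below below-next below-far : Fin n → ℕ
    below      i = count (λ j → adj π i j ∧ (h j <ᵇ h i))
    below-next i = count (λ j → adj π i j ∧ (h j <ᵇ h i) ∧ (suc (h j) ≡ᵇ h i))
    below-far  i = count (λ j → adj π i j ∧ (h j <ᵇ h i) ∧ not (suc (h j) ≡ᵇ h i))

    below-split : ∀ i → below i ≡ below-next i + below-far i
    below-split i = trans (count-∧-split _ (λ j → suc (h j) ≡ᵇ h i))
      (cong₂ _+_ (count-cong (λ j → BP.∧-assoc (adj π i j) _ _)) (count-cong (λ j → BP.∧-assoc (adj π i j) _ _)))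

    deg-split-h : ∀ i → deg π i ≡ lam π s par i + mu π s par i + below i
    deg-split-h = deg-split h

    nu-root : nu π s par s ≡ 0
    nu-root rewrite ≡⇒==≡true {i = s} refl = refl

    nu-nonroot : ∀ {i} → i ≢ s → nu π s par i ≡ count (λ j → adj π i j ∧ (suc (h j) ≡ᵇ h i) ∧ (j <ᶠ par i))
    nu-nonroot i≢s rewrite ≢⇒==≡false i≢s = refl

    -- ν counts the candidate parents below par i; par i itself is one more candidate.
    nu<below-next : ∀ {i} → i ≢ s → nu π s par i < below-next i
    nu<below-next {i} i≢s rewrite nu-nonroot i≢s = count-mono-< smaller⊆candidates (par i) parent-not-smaller parent-candidate
      where
      smaller⊆candidates : (λ j → adj π i j ∧ (suc (h j) ≡ᵇ h i) ∧ (j <ᶠ par i))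
                        ⊆ᵇ (λ j → adj π i j ∧ (h j <ᵇ h i) ∧ (suc (h j) ≡ᵇ h i))
      smaller⊆candidates j e = ∧-true⁺ {adj π i j} (∧-true⁻ˡ {adj π i j} e)
          (∧-true⁺ {h j <ᵇ h i} (<⇒<ᵇ≡true (NP.≤-reflexive (≡ᵇ≡true⇒≡ {suc (h j)} {h i} next))) next)
        where
        next : (suc (h j) ≡ᵇ h i) ≡ true
        next = ∧-true⁻ˡ {suc (h j) ≡ᵇ h i} (∧-true⁻ʳ {adj π i j} e)
      parent-not-smaller : (adj π i (par i) ∧ (suc (h (par i)) ≡ᵇ h i) ∧ (par i <ᶠ par i)) ≡ false
      parent-not-smaller rewrite n<ᵇn≡false (toℕ (par i)) | BP.∧-zeroʳ (suc (h (par i)) ≡ᵇ h i) = BP.∧-zeroʳ _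
      parent-candidate : (adj π i (par i) ∧ (h (par i) <ᵇ h i) ∧ (suc (h (par i)) ≡ᵇ h i)) ≡ true
      parent-candidate rewrite h-parent i≢s =
        ∧-true⁺ {adj π i (par i)} (parent-adj i≢s)
          (∧-true⁺ {h (par i) <ᵇ suc (h (par i))} (<⇒<ᵇ≡true (NP.n<1+n (h (par i))))
                                                  (≡⇒≡ᵇ≡true {suc (h (par i))} refl))

    config-root : c s ≡ deg π s
    config-root = begin
        lam π s par s + mu π s par s + nu π s par s  ≡⟨ cong₂ _+_ (cong₂ _+_ lam-root mu-root) nu-root ⟩
        deg π s + 0 + 0                              ≡⟨ trans (NP.+-identityʳ _) (NP.+-identityʳ _) ⟩
        deg π s                                      ∎
      where
      open ≡-Reasoning
      neighbour-above : ∀ {j} → adj π s j ≡ true → 0 < h j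
      neighbour-above {j} a = NP.n≢0⇒n>0 (λ e → adj⇒≢ a (sym (h≡0⇒root e)))
      lam-root : lam π s par s ≡ deg π s
      lam-root = count-cong lam-term
        where
        lam-term : ∀ j → adj π s j ∧ (h s <ᵇ h j) ≡ adj π s j
        lam-term j with adj π s j in a
        ... | false = refl
        ... | true rewrite h-root = <⇒<ᵇ≡true (neighbour-above a)
      mu-root : mu π s par s ≡ 0
      mu-root = trans (count-cong mu-term) (count-none {n})
        where
        mu-term : ∀ j → adj π s j ∧ (h j ≡ᵇ h s) ≡ false
        mu-term j with adj π s j in a
        ... | false = refl
        ... | true rewrite h-root = ≢⇒≡ᵇ≡false (λ e → NP.<-irrefl (sym e) (neighbour-above a))

    config-stable : ∀ i → i ≢ s → c i < deg π i
    config-stable i i≢s rewrite deg-split-h i = NP.+-monoʳ-< (lam π s par i + mu π s par i)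
      (NP.<-≤-trans (nu<below-next i≢s) (subst (below-next i ≤_) (sym (below-split i)) (NP.m≤m+n _ _)))

    deg≤config+below : ∀ i → deg π i ≤ c i + below i
    deg≤config+below i = by-cases (i F.≟ s)
      where
      by-cases : Dec (i ≡ s) → deg π i ≤ c i + below i
      by-cases (yes i≡s) = subst (λ x → deg π x ≤ c x + below x) (sym i≡s)
                             (subst (_≤ c s + below s) config-root (NP.m≤m+n (c s) (below s)))
      by-cases (no i≢s) rewrite deg-split-h i =
        NP.+-monoˡ-≤ (below i) (NP.m≤m+n (lam π s par i + mu π s par i) (nu π s par i))

    config+far<deg : ∀ j → j ≢ s → ∀ {m} → m ≤ below-far j → c j + m < deg π j
    config+far<deg j j≢s {m} m≤far
      rewrite deg-split-h j | below-split j | NP.+-assoc (lam π s par j + mu π s par j) (nu π s par j) m =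
      NP.+-monoʳ-< (lam π s par j + mu π s par j) (NP.+-mono-<-≤ (nu<below-next j≢s) m≤far)

    candidates : Fin n → Fin n → Bool
    candidates i j = adj π i j ∧ (suc (h j) ≡ᵇ h i)

    parent-candidate : ∀ {i} → i ≢ s → candidates i (par i) ≡ true
    parent-candidate {i} i≢s = ∧-true⁺ {adj π i (par i)} (parent-adj i≢s) (≡⇒≡ᵇ≡true (sym (h-parent i≢s)))

    nu≡rank : ∀ {i} → i ≢ s → nu π s par i ≡ rank (candidates i) (par i)
    nu≡rank {i} i≢s = trans (nu-nonroot i≢s) (count-cong (λ j → sym (BP.∧-assoc (adj π i j) _ _)))

    open Canonical s c config-root config-stable public

    private
      module LayerStep (k : ℕ) (D : ∀ i → done (suc k) i ≡ (h i <ᵇ suc k)) where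

        lower : ∀ {j} → h j < suc k → block (suc k) j ≡ false
        lower {j} lt with block (suc k) j in b
        ... | false = refl
        ... | true  = ⊥-elim (true≢false (trans (sym (trans (D j) (<⇒<ᵇ≡true lt))) (block-fresh (suc k) j b)))

        same : ∀ {j} → h j ≡ suc k → block (suc k) j ≡ true
        same {j} hj = block-suc⁺ k j≢s not-done (subst (λ x → deg π j ≤ c j + x) below≡inflow (deg≤config+below j))
          where
          j≢s : j ≢ s
          j≢s j≡s = NP.0≢1+n (trans (sym h-root) (trans (cong h (sym j≡s)) hj))
          not-done : done (suc k) j ≡ false
          not-done = trans (D j) (≮⇒<ᵇ≡false (NP.<-irrefl hj))
          below≡inflow : below j ≡ inflow (suc k) j
          below≡inflow = trans (count-cong (λ i → cong (λ x → adj π j i ∧ (h i <ᵇ x)) hj)) (sym (inflow-by-key h (suc k) j D))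

        higher : ∀ {j} → suc k < h j → block (suc k) j ≡ false
        higher {j} gt with block (suc k) j in b
        ... | false = refl
        ... | true  = ⊥-elim (NP.<-irrefl refl
                        (NP.<-≤-trans (config+far<deg j (block-suc⇒≢sink {k} b) inflow≤far) (block-suc⁻ k b)))
          where
          inflow≤far : inflow (suc k) j ≤ below-far j
          inflow≤far = subst (_≤ below-far j) (sym (inflow-by-key h (suc k) j D)) (count-mono far)
            where
            far : (λ i → adj π j i ∧ (h i <ᵇ suc k)) ⊆ᵇ (λ i → adj π j i ∧ (h i <ᵇ h j) ∧ not (suc (h i) ≡ᵇ h j))
            far i e = ∧-true⁺ {adj π j i} (∧-true⁻ˡ {adj π j i} e)
              (∧-true⁺ {h i <ᵇ h j} (<⇒<ᵇ≡true (NP.<-trans hi<1+k gt))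
                (cong not (≢⇒≡ᵇ≡false (λ e′ → NP.<-irrefl e′ (NP.≤-<-trans (s≤s (NP.≤-pred hi<1+k)) gt)))))
              where
              hi<1+k : h i < suc k
              hi<1+k = <ᵇ≡true⇒< (∧-true⁻ʳ {adj π j i} e)

    canonical-layers : ∀ k → (∀ i → done k i ≡ (h i <ᵇ k)) × (∀ i → block k i ≡ (h i ≡ᵇ k))
    canonical-layers zero = (λ _ → refl) , block-zero
      where
      block-zero : ∀ i → block zero i ≡ (h i ≡ᵇ 0)
      block-zero i with i F.≟ s
      ... | yes refl rewrite h-root = refl
      ... | no  i≢s  rewrite h-parent i≢s = refl
    canonical-layers (suc k) = D , block-suc
      where
      D : ∀ i → done (suc k) i ≡ (h i <ᵇ suc k)
      D i = trans (cong₂ _∨_ (proj₁ (canonical-layers k) i) (proj₂ (canonical-layers k) i)) (<ᵇ∨≡ᵇ (h i) k)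
      open LayerStep k D
      block-suc : ∀ j → block (suc k) j ≡ (h j ≡ᵇ suc k)
      block-suc j with NP.<-cmp (h j) (suc k)
      ... | tri< lt _ _ rewrite ≢⇒≡ᵇ≡false (λ e → NP.<-irrefl e lt) = lower lt
      ... | tri≈ _ eq _ rewrite ≡⇒≡ᵇ≡true eq = same eq
      ... | tri> _ _ gt rewrite ≢⇒≡ᵇ≡false (λ e → NP.<-irrefl (sym e) gt) = higher gt

    private
      module ByHeight = Sort (On.decTotalOrder NP.≤-decTotalOrder h)

      unstable-once-below-toppled : ∀ {c′ E v} → Toppled c E c′ → E v ≡ false →
        (∀ i → adj π v i ≡ true → h i < h v → E i ≡ true) → deg π v ≤ c′ v
      unstable-once-below-toppled {c′} {E} {v} t Ev below-toppled =
        NP.≤-trans (deg≤config+below v)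
          (subst (c v + below v ≤_) (sym (Toppled-untoppled t Ev)) (NP.+-monoʳ-≤ (c v) (count-mono below⊆received)))
        where
        below⊆received : (λ i → adj π v i ∧ (h i <ᵇ h v)) ⊆ᵇ (λ i → E i ∧ adj π i v)
        below⊆received i e =
          ∧-true⁺ {E i} (below-toppled i (∧-true⁻ˡ {adj π v i} e) (<ᵇ≡true⇒< (∧-true⁻ʳ {adj π v i} e)))
                                            (trans (adj-sym i v) (∧-true⁻ˡ {adj π v i} e))

    legal-by-height : ∀ vs {c′ E} → Toppled c E c′ → All (λ w → E w ≡ false) vs → Unique vs →
      AllPairs (λ a b → h a ≤ h b) vs → (∀ i → E i ≡ false → i ∈ vs) → LegalSeq π c′ vs
    legal-by-height []       _ _ _ _ _ = tt
    legal-by-height (v ∷ vs) {c′} {E} t (Ev ∷ untoppled) (v∉vs ∷ unique) (v≤vs ∷ sorted) covered =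
      unstable , legal-by-height vs (Toppled-topple v t Ev unstable) (untoppled-after {E} untoppled v∉vs) unique sorted covered′
      where
      below-toppled : ∀ i → adj π v i ≡ true → h i < h v → E i ≡ true
      below-toppled i _ hi<hv with E i in Ei
      ... | true  = refl
      ... | false with covered i Ei
      ...   | here refl = ⊥-elim (NP.<-irrefl refl hi<hv)
      ...   | there i∈vs = ⊥-elim (NP.<-irrefl refl (NP.<-≤-trans hi<hv (All.lookup v≤vs i∈vs)))
      unstable : deg π v ≤ c′ v
      unstable = unstable-once-below-toppled t Ev below-toppled
      covered′ : ∀ i → E i ∨ (i == v) ≡ false → i ∈ vs
      covered′ i e with covered i (proj₁ (∨-false⁻ {E i} e))
      ... | here i≡v   = ⊥-elim (true≢false (trans (sym (≡⇒==≡true i≡v)) (proj₂ (∨-false⁻ {E i} e))))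
      ... | there i∈vs = i∈vs

    recurrent : Recurrent π s c
    recurrent = config-root , config-stable , from-sorted order (ByHeight.sort-↭ (allFin n)) unique sorted
      where
      order : List (Fin n)
      order = ByHeight.sort (allFin n)
      unique : Unique order
      unique = PermSetoid.Unique-resp-↭ (setoid (Fin n)) (↭⇒↭ₛ (↭-sym (ByHeight.sort-↭ (allFin n)))) (allFin⁺ n)
      sorted : AllPairs (λ a b → h a ≤ h b) order
      sorted = Sorted⇒AllPairs (DecTotalOrder.totalOrder (On.decTotalOrder NP.≤-decTotalOrder h)) (ByHeight.sort-↗ (allFin n))
      head-is-root : ∀ {x rest} → (x ∷ rest) ↭ allFin n → AllPairs (λ a b → h a ≤ h b) (x ∷ rest) → x ≡ s
      head-is-root {x} perm (x≤rest ∷ _) with ∈-resp-↭ (↭-sym perm) (∈-allFin s)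
      ... | here s≡x     = sym s≡x
      ... | there s∈rest = h≡0⇒root (NP.n≤0⇒n≡0 (subst (h x ≤_) h-root (All.lookup x≤rest s∈rest)))
      from-sorted : ∀ L → L ↭ allFin n → Unique L → AllPairs (λ a b → h a ≤ h b) L →
                    Σ (List (Fin n)) (λ rest → ((s ∷ rest) ↭ allFin n) × LegalSeq π c (s ∷ rest))
      from-sorted [] perm _ _ with ∈-resp-↭ (↭-sym perm) (∈-allFin s)
      ... | ()
      from-sorted (x ∷ rest) perm u so with head-is-root perm so
      ... | refl = rest , perm , legal-by-height (x ∷ rest) (Toppled-none c) (All.universal (λ _ → refl) _) u so
                                   (λ i _ → ∈-resp-↭ (↭-sym perm) (∈-allFin i))

    -- Both sides count the pairs (i, j) of adjacent vertices with h i < h j.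
    Σlam≡Σbelow : Σᶠ (lam π s par) ≡ Σᶠ below
    Σlam≡Σbelow = trans (Σᶠ-count-comm (λ i j → adj π i j ∧ (h i <ᵇ h j)))
      (Σᶠ-cong (λ j → count-cong (λ i → cong (_∧ (h i <ᵇ h j)) (adj-sym i j))))

    level-formula : ℤ+ 2 *ℤ level π c ≡ ℤ+ (Σᶠ (λ i → mu π s par i + 2 * nu π s par i))
    level-formula rewrite Σᶠ-+ (mu π s par) (λ i → 2 * nu π s par i) | Σᶠ-*ˡ 2 (nu π s par) =
      2*[m-n]≡k (Σᶠ c) (numEdges π) (M + 2 * V) chips
      where
      Λ M V E : ℕ
      Λ = Σᶠ (lam π s par)
      M = Σᶠ (mu π s par)
      V = Σᶠ (nu π s par)
      E = numEdges π
      Σconfig : Σᶠ c ≡ Λ + M + V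
      Σconfig = trans (Σᶠ-+ (λ i → lam π s par i + mu π s par i) (nu π s par))
                      (cong (_+ V) (Σᶠ-+ (lam π s par) (mu π s par)))
      edges : E + E ≡ Λ + M + Λ
      edges = begin
        E + E                                   ≡⟨ sym handshake ⟩
        Σᶠ (deg π)                              ≡⟨ Σᶠ-cong deg-split-h ⟩
        Σᶠ (λ i → lam π s par i + mu π s par i + below i)
                                                ≡⟨ Σᶠ-+ (λ i → lam π s par i + mu π s par i) below ⟩
        Σᶠ (λ i → lam π s par i + mu π s par i) + Σᶠ below
                                                ≡⟨ cong₂ _+_ (Σᶠ-+ (lam π s par) (mu π s par)) (sym Σlam≡Σbelow) ⟩
        Λ + M + Λ                               ∎
        where open ≡-Reasoning
      rearrange : ∀ L M V → (L + M + V) + (L + M + V) ≡ (L + M + L) + (M + 2 * V)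
      rearrange = solve-∀
      chips : Σᶠ c + Σᶠ c ≡ (E + E) + (M + 2 * V)
      chips rewrite Σconfig | edges = rearrange Λ M V

  -- Injectivity

  canonical-step-cong : ∀ s {c d : Config n} → c ≗ d → ∀ k →
    (proj₁ (canonical-step π s c k) ≗ proj₁ (canonical-step π s d k)) × (canonical π s c k ≗ canonical π s d k)
  canonical-step-cong s c≗d zero    = c≗d , (λ _ → refl)
  canonical-step-cong s {c} {d} c≗d (suc k) with canonical-step-cong s c≗d k
  ... | stage≗ , block≗ = stage-eq , (λ j → cong (λ x → not (j == s) ∧ (deg π j <ᵇ suc x)) (stage-eq j))
    where
    stage-eq : proj₁ (canonical-step π s c (suc k)) ≗ proj₁ (canonical-step π s d (suc k))
    stage-eq j = cong₂ _∸_ (cong₂ _+_ (stage≗ j) (count-cong (λ i → cong (_∧ adj π i j) (block≗ i))))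
                           (cong (λ b → if b then deg π j else 0) (block≗ j))

  module _ (s : Fin n) (T T′ : Fin n → Fin n) (tree : IsSpanningTree π s T) (tree′ : IsSpanningTree π s T′)
           (same-config : treeConfig π s T ≗ treeConfig π s T′) where
    private
      module A = SpanningTree s T tree
      module B = SpanningTree s T′ tree′

    same-heights : ∀ i → A.h i ≡ B.h i
    same-heights i = sym (≡ᵇ≡true⇒≡ (begin
        B.h i ≡ᵇ A.h i                              ≡⟨ sym (proj₂ (B.canonical-layers (A.h i)) i) ⟩
        canonical π s B.c (A.h i) i                 ≡⟨ sym (proj₂ (canonical-step-cong s same-config (A.h i)) i) ⟩
        canonical π s A.c (A.h i) i                 ≡⟨ proj₂ (A.canonical-layers (A.h i)) i ⟩
        A.h i ≡ᵇ A.h i                              ≡⟨ ≡⇒≡ᵇ≡true {A.h i} refl ⟩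
        true                                        ∎))
      where open ≡-Reasoning

    same-nu : ∀ i → nu π s T i ≡ nu π s T′ i
    same-nu i = NP.+-cancelˡ-≡ (lam π s T′ i + mu π s T′ i) _ _
                  (trans (cong₂ (λ x y → x + y + nu π s T i) (sym same-lam) (sym same-mu)) (same-config i))
      where
      same-lam : lam π s T i ≡ lam π s T′ i
      same-lam = count-cong (λ j → cong₂ (λ x y → adj π i j ∧ (x <ᵇ y)) (same-heights i) (same-heights j))
      same-mu : mu π s T i ≡ mu π s T′ i
      same-mu = count-cong (λ j → cong₂ (λ x y → adj π i j ∧ (x ≡ᵇ y)) (same-heights j) (same-heights i))

    same-parents : T ≗ T′
    same-parents i with i F.≟ s
    ... | yes refl = trans (proj₁ tree) (sym (proj₁ tree′))
    ... | no  i≢s  = rank-injective (A.candidates i) (A.parent-candidate i≢s) candidate′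
                       (trans (sym (A.nu≡rank i≢s)) (trans (same-nu i) (trans (B.nu≡rank i≢s) (sym same-rank))))
      where
      same-candidates : A.candidates i ≗ B.candidates i
      same-candidates j = cong (λ x → adj π i j ∧ x) (cong₂ _≡ᵇ_ (cong suc (same-heights j)) (same-heights i))
      candidate′ : A.candidates i (T′ i) ≡ true
      candidate′ = trans (same-candidates (T′ i)) (B.parent-candidate i≢s)
      same-rank : rank (A.candidates i) (T′ i) ≡ rank (B.candidates i) (T′ i)
      same-rank = count-cong (λ j → cong (_∧ (j <ᶠ T′ i)) (same-candidates j))

  -- Surjectivity

  module FromRecurrent (s : Fin n) (c : Config n) (rec : Recurrent π s c) where
    open Canonical s c (proj₁ rec) (proj₁ (proj₂ rec))

    private
      rest : List (Fin n)
      rest = proj₁ (proj₂ (proj₂ rec))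
      perm : (s ∷ rest) ↭ allFin n
      perm = proj₁ (proj₂ (proj₂ (proj₂ rec)))

    legal⇒done : ∀ vs {c′ E} K → Toppled c E c′ → E ⊆ᵇ done K → All (λ w → E w ≡ false) vs → Unique vs →
                 LegalSeq π c′ vs → All (λ v → Σ ℕ (λ k → done k v ≡ true)) vs
    legal⇒done []       _ _ _ _ _ _ = []
    legal⇒done (v ∷ vs) {c′} {E} K t E⊆done (Ev ∷ untoppled) (v∉vs ∷ unique) (unstable , legal) =
      (suc K , v-done) ∷ legal⇒done vs (suc K) (Toppled-topple v t Ev unstable) E∪v⊆done
                                    (untoppled-after {E} untoppled v∉vs) unique legal
      where
      received≤inflow : received E v ≤ inflow K v
      received≤inflow = count-mono (λ i e → ∧-true⁺ {done K i} (E⊆done i (∧-true⁻ˡ {E i} e)) (∧-true⁻ʳ {E i} e))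
      v-done : done (suc K) v ≡ true
      v-done = unstable⇒done-suc K (NP.≤-trans unstable
                 (subst (_≤ c v + inflow K v) (sym (Toppled-untoppled t Ev)) (NP.+-monoʳ-≤ (c v) received≤inflow)))
      E∪v⊆done : (λ i → E i ∨ (i == v)) ⊆ᵇ done (suc K)
      E∪v⊆done i e with E i in Ei
      ... | true  = done-suc K (E⊆done i Ei)
      ... | false = subst (λ x → done (suc K) x ≡ true) (sym (==≡true⇒≡ e)) v-done

    every-vertex-done : ∀ v → Σ ℕ (λ k → done k v ≡ true)
    every-vertex-done v = All.lookup (All-resp-↭ perm all-done) (∈-allFin v)
      where
      unique : Unique (s ∷ rest)
      unique = PermSetoid.Unique-resp-↭ (setoid (Fin n)) (↭⇒↭ₛ (↭-sym perm)) (allFin⁺ n)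
      all-done : All (λ v → Σ ℕ (λ k → done k v ≡ true)) (s ∷ rest)
      all-done = legal⇒done (s ∷ rest) 0 (Toppled-none c) (λ _ ()) (All.universal (λ _ → refl) _) unique
                            (proj₂ (proj₂ (proj₂ (proj₂ rec))))

    first-block : ∀ k v → done k v ≡ true → Σ ℕ (λ m → m < k × block m v ≡ true)
    first-block (suc k) v e with block k v in b
    ... | true  = k , NP.n<1+n k , b
    ... | false with first-block k v (trans (sym (BP.∨-identityʳ (done k v))) e)
    ...   | m , m<k , bm = m , NP.m<n⇒m<1+n m<k , bm

    layer : Fin n → ℕ
    layer v = proj₁ (first-block (proj₁ (every-vertex-done v)) v (proj₂ (every-vertex-done v)))

    block-layer : ∀ v → block (layer v) v ≡ true
    block-layer v = proj₂ (proj₂ (first-block (proj₁ (every-vertex-done v)) v (proj₂ (every-vertex-done v))))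

    block-unique : ∀ {m m′} v → block m v ≡ true → block m′ v ≡ true → m ≡ m′
    block-unique {m} {m′} v b b′ with NP.<-cmp m m′
    ... | tri< m<m′ _ _ = ⊥-elim (true≢false (trans (sym (done-mono v m<m′ (block⇒done-suc m {v} b))) (block-fresh m′ v b′)))
    ... | tri≈ _ m≡m′ _ = m≡m′
    ... | tri> _ _ m′<m = ⊥-elim (true≢false (trans (sym (done-mono v m′<m (block⇒done-suc m′ {v} b′))) (block-fresh m v b)))

    done≡layer< : ∀ k v → done k v ≡ (layer v <ᵇ k)
    done≡layer< k v with done k v in d
    ... | true with first-block k v d
    ...   | m , m<k , bm = sym (<⇒<ᵇ≡true (subst (_< k) (block-unique v bm (block-layer v)) m<k))
    done≡layer< k v | false =
      sym (≮⇒<ᵇ≡false (λ lt → true≢false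
        (trans (sym (done-mono {suc (layer v)} {k} v lt (block⇒done-suc (layer v) {v} (block-layer v)))) d)))

    layer-root : layer s ≡ 0
    layer-root = sym (block-unique s (≡⇒==≡true {i = s} refl) (block-layer s))

    layer≡0⇒root : ∀ {v} → layer v ≡ 0 → v ≡ s
    layer≡0⇒root {v} e = ==≡true⇒≡ (subst (λ x → block x v ≡ true) e (block-layer v))

    layer-nonroot : ∀ {v} → v ≢ s → Σ ℕ (λ k → layer v ≡ suc k)
    layer-nonroot {v} v≢s with layer v in e
    ... | zero  = ⊥-elim (v≢s (layer≡0⇒root e))
    ... | suc k = k , refl

    lam′ mu′ : Fin n → ℕ
    lam′ v = count (λ j → adj π v j ∧ (layer v <ᵇ layer j))
    mu′  v = count (λ j → adj π v j ∧ (layer j ≡ᵇ layer v))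

    candidates : Fin n → Fin n → Bool
    candidates v j = adj π v j ∧ (suc (layer j) ≡ᵇ layer v)

    -- v is stable before stage layer v and unstable at it; the degree splits as λ + μ + (lower neighbours).
    config-bounds : ∀ {v} → v ≢ s → (lam′ v + mu′ v ≤ c v) × (c v < lam′ v + mu′ v + count (candidates v))
    config-bounds {v} v≢s with layer-nonroot v≢s
    ... | k , layer≡1+k = lower-bound , upper-bound
      where
      lower : ℕ
      lower = count (λ j → adj π v j ∧ (layer j <ᵇ layer v))
      lower≡inflow-suc : lower ≡ inflow (suc k) v
      lower≡inflow-suc =
        trans (count-cong (λ j → cong (λ x → adj π v j ∧ (layer j <ᵇ x)) layer≡1+k)) (sym (inflow-by-key layer (suc k) v (done≡layer< (suc k))))
      lower≡candidates+inflow : lower ≡ count (candidates v) + inflow k v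
      lower≡candidates+inflow = trans (count-∧-split _ (λ j → suc (layer j) ≡ᵇ layer v)) (cong₂ _+_
        (count-cong (λ j → trans (BP.∧-assoc (adj π v j) _ _) (cong (adj π v j ∧_) (<ᵇ∧1+≡ᵇ (layer j) (layer v)))))
        (trans (count-cong (λ j → trans (BP.∧-assoc (adj π v j) _ _) (cong (adj π v j ∧_)
                 (trans (cong (λ x → (layer j <ᵇ x) ∧ not (suc (layer j) ≡ᵇ x)) layer≡1+k) (<ᵇ1+∧not-≡ᵇ (layer j) k)))))
               (sym (inflow-by-key layer k v (done≡layer< k)))))
      deg≡ : deg π v ≡ lam′ v + mu′ v + lower
      deg≡ = deg-split layer v
      unstable-at-layer : deg π v ≤ c v + inflow (suc k) v
      unstable-at-layer = block-suc⁻ k (subst (λ x → block x v ≡ true) layer≡1+k (block-layer v))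
      stable-before-layer : c v + inflow k v < deg π v
      stable-before-layer = block-stable k v≢s not-done not-block
        where
        not-done : done k v ≡ false
        not-done = trans (done≡layer< k v) (≮⇒<ᵇ≡false (λ lt → NP.<-asym lt (subst (k <_) (sym layer≡1+k) (NP.n<1+n k))))
        not-block : block k v ≡ false
        not-block with block k v in b
        ... | false = refl
        ... | true  = ⊥-elim (NP.<-irrefl (trans (block-unique v b (block-layer v)) layer≡1+k) (NP.n<1+n k))
      lower-bound : lam′ v + mu′ v ≤ c v
      lower-bound = NP.+-cancelʳ-≤ (inflow (suc k) v) _ _
        (subst (_≤ c v + inflow (suc k) v) (trans deg≡ (cong (lam′ v + mu′ v +_) lower≡inflow-suc)) unstable-at-layer)
      upper-bound : c v < lam′ v + mu′ v + count (candidates v)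
      upper-bound = NP.+-cancelʳ-< (inflow k v) _ _
        (subst (c v + inflow k v <_) (trans deg≡ (trans (cong (lam′ v + mu′ v +_) lower≡candidates+inflow)
          (sym (NP.+-assoc (lam′ v + mu′ v) (count (candidates v)) (inflow k v))))) stable-before-layer)

    excess : Fin n → ℕ
    excess v = c v ∸ (lam′ v + mu′ v)

    excess<candidates : ∀ {v} → v ≢ s → excess v < count (candidates v)
    excess<candidates {v} v≢s = NP.+-cancelˡ-< (lam′ v + mu′ v) _ _
      (subst (_< lam′ v + mu′ v + count (candidates v)) (sym (NP.m+[n∸m]≡n (proj₁ (config-bounds v≢s))))
             (proj₂ (config-bounds v≢s)))

    -- The parent of v is the candidate of rank ν_v = excess v.
    parent : Fin n → Fin n
    parent v with v F.≟ s
    ... | yes _   = s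
    ... | no  v≢s = proj₁ (rank-surjective (candidates v) (excess v) (excess<candidates v≢s))

    parent-root : parent s ≡ s
    parent-root with s F.≟ s
    ... | yes _ = refl
    ... | no  s≢s = ⊥-elim (s≢s refl)

    parent-candidate : ∀ {v} → v ≢ s → candidates v (parent v) ≡ true × rank (candidates v) (parent v) ≡ excess v
    parent-candidate {v} v≢s with v F.≟ s
    ... | yes v≡s = ⊥-elim (v≢s v≡s)
    ... | no  v≢s = proj₂ (rank-surjective (candidates v) (excess v) (excess<candidates v≢s))

    layer-parent : ∀ {v} → v ≢ s → suc (layer (parent v)) ≡ layer v
    layer-parent {v} v≢s = ≡ᵇ≡true⇒≡ (∧-true⁻ʳ {adj π v (parent v)} (proj₁ (parent-candidate v≢s)))

    iter-parent-root : ∀ m v → layer v ≤ m → iter parent m v ≡ s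
    iter-parent-root zero    v le = layer≡0⇒root (NP.n≤0⇒n≡0 le)
    iter-parent-root (suc m) v le = trans (iter-suc parent m v) (by-cases (v F.≟ s))
      where
      by-cases : Dec (v ≡ s) → iter parent m (parent v) ≡ s
      by-cases (yes refl) = trans (cong (iter parent m) parent-root) (iter-fixed parent parent-root m)
      by-cases (no v≢s)   = iter-parent-root m (parent v) (NP.≤-pred (subst (_≤ suc m) (sym (layer-parent v≢s)) le))

    -- Following parents from v meets every earlier stage.
    block-nonempty : ∀ d v m → layer v ≡ d + m → Σ (Fin n) (λ w → block m w ≡ true)
    block-nonempty zero    v m e = v , subst (λ x → block x v ≡ true) e (block-layer v)
    block-nonempty (suc d) v m e with v F.≟ s
    ... | yes refl = ⊥-elim (NP.0≢1+n (trans (sym layer-root) e))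
    ... | no  v≢s  = block-nonempty d (parent v) m (NP.suc-injective (trans (layer-parent v≢s) e))

    m≤count-done : ∀ m → (∀ m′ → m′ < m → Σ (Fin n) (λ w → block m′ w ≡ true)) → m ≤ count (done m)
    m≤count-done zero    _         = z≤n
    m≤count-done (suc m) nonempty = subst (suc m ≤_) (sym (count-∨-disjoint (done m) (block m) disjoint))
        (subst (_≤ count (done m) + count (block m)) (NP.+-comm m 1)
          (NP.+-mono-≤ (m≤count-done m (λ m′ lt → nonempty m′ (NP.m<n⇒m<1+n lt)))
            (subst (_< count (block m)) (count-none {n}) (count-mono-< (λ _ ()) w refl bw))))
      where
      w : Fin n
      w = proj₁ (nonempty m (NP.n<1+n m))
      bw : block m w ≡ true
      bw = proj₂ (nonempty m (NP.n<1+n m))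
      disjoint : ∀ i → done m i ∧ block m i ≡ false
      disjoint i with block m i in b
      ... | false = BP.∧-zeroʳ _
      ... | true rewrite block-fresh m i b = refl

    layer<n : ∀ v → layer v < n
    layer<n v = NP.≤-trans (m≤count-done (suc (layer v)) nonempty) (count≤n (done (suc (layer v))))
      where
      nonempty : ∀ m → m < suc (layer v) → Σ (Fin n) (λ w → block m w ≡ true)
      nonempty m lt = block-nonempty (layer v ∸ m) v m (sym (NP.m∸n+n≡m (NP.≤-pred lt)))

    tree : IsSpanningTree π s parent
    tree = parent-root
         , (λ v v≢s → ∧-true⁻ˡ {adj π v (parent v)} (proj₁ (parent-candidate v≢s)))
         , (λ v → iter-parent-root n v (NP.<⇒≤ (layer<n v)))

    private
      module Tree = SpanningTree s parent tree

    height≡layer : ∀ v → Tree.h v ≡ layer v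
    height≡layer v = go (layer v) v refl
      where
      go : ∀ m v → layer v ≡ m → Tree.h v ≡ m
      go zero    v e rewrite layer≡0⇒root e = Tree.h-root
      go (suc m) v e with v F.≟ s
      ... | yes refl = ⊥-elim (NP.0≢1+n (trans (sym layer-root) e))
      ... | no  v≢s  = trans (Tree.h-parent v≢s) (cong suc (go m (parent v) (NP.suc-injective (trans (layer-parent v≢s) e))))

    config-of-tree : treeConfig π s parent ≗ c
    config-of-tree v = by-cases (v F.≟ s)
      where
      by-cases : Dec (v ≡ s) → treeConfig π s parent v ≡ c v
      by-cases (yes v≡s) = subst (λ x → treeConfig π s parent x ≡ c x) (sym v≡s) (trans Tree.config-root (sym (proj₁ rec)))
      by-cases (no v≢s) = begin
          lam π s parent v + mu π s parent v + nu π s parent v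
            ≡⟨ cong₂ (λ x y → x + y + nu π s parent v) same-lam same-mu ⟩
          lam′ v + mu′ v + nu π s parent v                      ≡⟨ cong (lam′ v + mu′ v +_) nu≡excess ⟩
          lam′ v + mu′ v + excess v                             ≡⟨ NP.m+[n∸m]≡n (proj₁ (config-bounds v≢s)) ⟩
          c v                                                   ∎
        where
        open ≡-Reasoning
        same-lam : lam π s parent v ≡ lam′ v
        same-lam = count-cong (λ j → cong₂ (λ x y → adj π v j ∧ (x <ᵇ y)) (height≡layer v) (height≡layer j))
        same-mu : mu π s parent v ≡ mu′ v
        same-mu = count-cong (λ j → cong₂ (λ x y → adj π v j ∧ (x ≡ᵇ y)) (height≡layer j) (height≡layer v))
        nu≡excess : nu π s parent v ≡ excess v
        nu≡excess = trans (Tree.nu≡rank v≢s) (trans (count-cong (λ j → cong (λ b → b ∧ (j <ᶠ parent v))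
                      (cong (adj π v j ∧_) (cong₂ _≡ᵇ_ (cong suc (height≡layer j)) (height≡layer v)))))
                      (proj₂ (parent-candidate v≢s)))

theorem3p1 : ∀ (n : ℕ) (π : Permutation′ n) → Indecomposable π → (s : Fin n) →
      (∀ (T : Fin n → Fin n) → IsSpanningTree π s T → Recurrent π s (treeConfig π s T))
    × (∀ (T T′ : Fin n → Fin n) → IsSpanningTree π s T → IsSpanningTree π s T′ →
         treeConfig π s T ≗ treeConfig π s T′ → T ≗ T′)
    × (∀ (c : Config n) → Recurrent π s c →
         Σ (Fin n → Fin n) (λ T → IsSpanningTree π s T × (treeConfig π s T ≗ c)))
    × (∀ (T : Fin n → Fin n) → IsSpanningTree π s T →
         ℤ+ 2 *ℤ level π (treeConfig π s T) ≡ ℤ+ (Σᶠ (λ i → mu π s T i + 2 * nu π s T i)))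
    × (∀ (T : Fin n → Fin n) → IsSpanningTree π s T →
         ∀ (k : ℕ) (i : Fin n) → canonical π s (treeConfig π s T) k i ≡ (height s T i ≡ᵇ k))
theorem3p1 n π _ s =
    (λ T tree → SpanningTree.recurrent π s T tree)
  , (λ T T′ tree tree′ same → same-parents π s T T′ tree tree′ same)
  , (λ c rec → let open FromRecurrent π s c rec in parent , tree , config-of-tree)
  , (λ T tree → SpanningTree.level-formula π s T tree)
  , (λ T tree k → proj₂ (SpanningTree.canonical-layers π s T tree k))
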